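{- Let $\mu:\{0,1\}^*\to\{0,1\}^*$ be defined by $\mu(0)=01$, $\mu(1)=10$. Let $\mathbf{z}=z_0z_1z_2\cdots$ be an infinite binary word and $\mathbf{x}=x_0x_1x_2\cdots=\mu(\mathbf{z})$, and let $n\ge0$ be an integer. If an Abelian $3$-power with period $\ell$ occurs at position $2n+1$ in $\mathbf{x}$ (i.e. $x_{2n+1}x_{2n+2}\cdots x_{2n+3\ell}$ is an Abelian 3-power $u_1u_2u_3$ with $|u_1|=\ell$), then $\ell=2k$ for some integer $k$ and $z_n=z_{n+k}=z_{n+2k}$.
   Context: Two finite words are Abelian equivalent if each letter occurs the same number of times in both. A nonempty word $w$ is an Abelian $3$-power with period $\ell$ if $w=u_1u_2u_3$ with $u_1,u_2,u_3$ pairwise Abelian equivalent and $|u_1|=\ell$. -}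

module Defs where

open import Data.Bool using (Bool; true; false; not)
open import Data.Bool.Properties using () renaming (_≟_ to _≟ᵇ_)
open import Data.Nat using (ℕ; zero; suc; _+_; _≤_)
open import Data.List using (List; []; _∷_; _++_; length; filter; map; upTo)
open import Data.Product using (Σ; _×_; ∃-syntax)
open import Relation.Binary.PropositionalEquality using (_≡_)

-- Binary alphabet {0,1} encoded as Bool with 0 = false, 1 = true.
-- Infinite binary words are functions ℕ → Bool.
InfWord : Set
InfWord = ℕ → Bool

μ : Bool → List Bool
μ b = b ∷ not b ∷ []

μ∞ : InfWord → InfWord
μ∞ z zero          = z 0
μ∞ z (suc zero)    = not (z 0)
μ∞ z (suc (suc i)) = μ∞ (λ j → z (suc j)) i

factor : InfWord → ℕ → ℕ → List Bool
factor x p len = map (λ i → x (p + i)) (upTo len)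

occ : Bool → List Bool → ℕ
occ a w = length (filter (_≟ᵇ a) w)

AbelianEquiv : List Bool → List Bool → Set
AbelianEquiv u v = ∀ a → occ a u ≡ occ a v

-- w is an Abelian 3-power with period ℓ: w nonempty, w = u₁u₂u₃,
-- u₁,u₂,u₃ pairwise Abelian equivalent, |u₁| = ℓ.
-- (Nonemptiness of w is equivalent to ℓ ≥ 1 given the rest.)
Abelian3Power : List Bool → ℕ → Set
Abelian3Power w ℓ =
  1 ≤ length w ×
  (∃[ u₁ ] ∃[ u₂ ] ∃[ u₃ ]
     (w ≡ u₁ ++ u₂ ++ u₃) × (length u₁ ≡ ℓ) ×
     AbelianEquiv u₁ u₂ × AbelianEquiv u₁ u₃ × AbelianEquiv u₂ u₃)

module Submission where

-- Write x = μ(z).  Every aligned pair x₂ᵢx₂ᵢ₊₁ = zᵢ(¬zᵢ) contains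
-- exactly one 1, so the number of 1s in a factor of x is determined up to its
-- two end letters: a factor of length 2m starting at an even position has m
-- ones, and the other three parity combinations differ from this by the value
-- of the letters sticking out of the aligned pairs at either end.
--
-- The three blocks u₁u₂u₃ of an Abelian 3-power at position 2n+1 are the
-- consecutive windows of length ℓ at 2n+1, 2n+1+ℓ, 2n+1+2ℓ, so consecutive
-- blocks contain equally many 1s.
--   * ℓ = 2j+1: u₂ (even start) has j + zₖ ones and u₃ (odd start) has
--     (1 - zₖ) + j ones for the same k = n+2j+1, which is impossible.
--   * ℓ = 2k:   u₁, u₂ have (1 - zₙ) + (k-1) + zₙ₊ₖ and (1 - zₙ₊ₖ) + (k-1) + zₙ₊₂ₖ
--     ones; for bits this equality forces zₙ = zₙ₊ₖ = zₙ₊₂ₖ.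

open import Defs
open import Data.Bool using (Bool; true; false; not)
open import Data.Empty using (⊥; ⊥-elim)
open import Data.List using (List; []; _∷_; _++_; length; filter; applyUpTo)
open import Data.List.Properties using (filter-++; length-++; map-upTo; ∷-injective)
open import Data.Nat using (ℕ; zero; suc; _+_; _*_; pred)
open import Data.Nat.Properties using (+-suc; +-comm; +-identityʳ; +-cancelˡ-≡; +-commutativeSemigroup)
open import Algebra.Properties.CommutativeSemigroup +-commutativeSemigroup using (x∙yz≈y∙xz)
open import Data.Nat.Tactic.RingSolver using (solve-∀)
open import Data.Product using (_×_; _,_; proj₁; proj₂; ∃-syntax)
open import Data.Sum using (_⊎_; inj₁; inj₂)
open import Relation.Binary.PropositionalEquality
  using (_≡_; refl; sym; trans; cong; cong₂; subst; module ≡-Reasoning)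

open ≡-Reasoning

-- The factor x_p ⋯ x_{p+m-1}, by recursion on m so that it unfolds letter by letter.
window : InfWord → ℕ → ℕ → List Bool
window x p zero    = []
window x p (suc m) = x p ∷ window x (suc p) m

applyUpTo≡window : ∀ x p m (f : ℕ → Bool) → (∀ i → f i ≡ x (p + i)) →
                   applyUpTo f m ≡ window x p m
applyUpTo≡window x p zero    f f≡ = refl
applyUpTo≡window x p (suc m) f f≡ =
  cong₂ _∷_ (trans (f≡ 0) (cong x (+-identityʳ p)))
            (applyUpTo≡window x (suc p) m (λ i → f (suc i))
               (λ i → trans (f≡ (suc i)) (cong x (+-suc p i))))

factor≡window : ∀ x p m → factor x p m ≡ window x p m
factor≡window x p m =
  trans (map-upTo (λ i → x (p + i)) m) (applyUpTo≡window x p m _ (λ i → refl))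

length-window : ∀ x p m → length (window x p m) ≡ m
length-window x p zero    = refl
length-window x p (suc m) = cong suc (length-window x (suc p) m)

window-++ : ∀ x p a b → window x p (a + b) ≡ window x p a ++ window x (p + a) b
window-++ x p zero    b = cong (λ q → window x q b) (sym (+-identityʳ p))
window-++ x p (suc a) b =
  cong (x p ∷_) (trans (window-++ x (suc p) a b)
                       (cong (λ q → window x (suc p) a ++ window x q b) (sym (+-suc p a))))

++-splitAt-length : ∀ {A : Set} (u r v s : List A) → length u ≡ length v →
                    u ++ r ≡ v ++ s → u ≡ v × r ≡ s
++-splitAt-length []      r []      s _     eq = refl , eq
++-splitAt-length (a ∷ u) r (b ∷ v) s |u|≡ eq =
  let a≡b , rest = ∷-injective eq
      u≡v , r≡s  = ++-splitAt-length u r v s (cong pred |u|≡) rest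
  in cong₂ _∷_ a≡b u≡v , r≡s

ones : List Bool → ℕ
ones = occ true

bit : Bool → ℕ
bit false = 0
bit true  = 1

ones-∷ : ∀ b w → ones (b ∷ w) ≡ bit b + ones w
ones-∷ false w = refl
ones-∷ true  w = refl

ones-pair : ∀ b w → ones (b ∷ not b ∷ w) ≡ suc (ones w)
ones-pair false w = refl
ones-pair true  w = refl

occ-++ : ∀ a u v → occ a (u ++ v) ≡ occ a u + occ a v
occ-++ a u v = trans (cong length (filter-++ _ u v)) (length-++ (filter _ u))

length≡ones+zeros : ∀ w → length w ≡ occ true w + occ false w
length≡ones+zeros []          = refl
length≡ones+zeros (true ∷ w)  = cong suc (length≡ones+zeros w)
length≡ones+zeros (false ∷ w) =
  trans (cong suc (length≡ones+zeros w)) (sym (+-suc (occ true w) (occ false w)))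

abelianEquiv⇒length : ∀ u v → AbelianEquiv u v → length u ≡ length v
abelianEquiv⇒length u v u~v = begin
  length u                  ≡⟨ length≡ones+zeros u ⟩
  occ true u + occ false u  ≡⟨ cong₂ _+_ (u~v true) (u~v false) ⟩
  occ true v + occ false v  ≡⟨ length≡ones+zeros v ⟨
  length v                  ∎

abelian3Power⇒equalOnes : ∀ x p ℓ → Abelian3Power (factor x p (3 * ℓ)) ℓ →
  ones (window x p ℓ) ≡ ones (window x (p + ℓ) ℓ) ×
  ones (window x (p + ℓ) ℓ) ≡ ones (window x (p + ℓ + ℓ) ℓ)
abelian3Power⇒equalOnes x p ℓ (_ , u₁ , u₂ , u₃ , w≡ , |u₁| , u₁~u₂ , _ , u₂~u₃) =
  trans (cong ones (sym u₁≡)) (trans (u₁~u₂ true) (cong ones u₂≡)) ,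
  trans (cong ones (sym u₂≡)) (trans (u₂~u₃ true) (cong ones u₃≡))
  where
  blocks : u₁ ++ u₂ ++ u₃ ≡ window x p ℓ ++ window x (p + ℓ) ℓ ++ window x (p + ℓ + ℓ) ℓ
  blocks = begin
    u₁ ++ u₂ ++ u₃
      ≡⟨ sym w≡ ⟩
    factor x p (ℓ + (ℓ + (ℓ + 0)))
      ≡⟨ factor≡window x p (3 * ℓ) ⟩
    window x p (ℓ + (ℓ + (ℓ + 0)))
      ≡⟨ window-++ x p ℓ (ℓ + (ℓ + 0)) ⟩
    window x p ℓ ++ window x (p + ℓ) (ℓ + (ℓ + 0))
      ≡⟨ cong (window x p ℓ ++_) (window-++ x (p + ℓ) ℓ (ℓ + 0)) ⟩
    window x p ℓ ++ window x (p + ℓ) ℓ ++ window x (p + ℓ + ℓ) (ℓ + 0)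
      ≡⟨ cong (λ m → window x p ℓ ++ window x (p + ℓ) ℓ ++ window x (p + ℓ + ℓ) m)
              (+-identityʳ ℓ) ⟩
    window x p ℓ ++ window x (p + ℓ) ℓ ++ window x (p + ℓ + ℓ) ℓ
      ∎

  split₁ : u₁ ≡ window x p ℓ × u₂ ++ u₃ ≡ window x (p + ℓ) ℓ ++ window x (p + ℓ + ℓ) ℓ
  split₁ = ++-splitAt-length u₁ _ _ _ (trans |u₁| (sym (length-window x p ℓ))) blocks
  u₁≡ = proj₁ split₁

  |u₂| : length u₂ ≡ ℓ
  |u₂| = trans (sym (abelianEquiv⇒length u₁ u₂ u₁~u₂)) |u₁|

  split₂ : u₂ ≡ window x (p + ℓ) ℓ × u₃ ≡ window x (p + ℓ + ℓ) ℓ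
  split₂ = ++-splitAt-length u₂ u₃ _ _ (trans |u₂| (sym (length-window x (p + ℓ) ℓ)))
                             (proj₂ split₁)
  u₂≡ = proj₁ split₂
  u₃≡ = proj₂ split₂

μ∞-even : ∀ z i → μ∞ z (i + i) ≡ z i
μ∞-even z zero    = refl
μ∞-even z (suc i) rewrite +-suc i i = μ∞-even (λ j → z (suc j)) i

μ∞-odd : ∀ z i → μ∞ z (suc (i + i)) ≡ not (z i)
μ∞-odd z zero    = refl
μ∞-odd z (suc i) rewrite +-suc i i = μ∞-odd (λ j → z (suc j)) i

module WindowCounts (z : InfWord) where

  x : InfWord
  x = μ∞ z

  nextPair : ∀ i → suc (suc (i + i)) ≡ suc i + suc i
  nextPair i = cong suc (sym (+-suc i i))

  ones-leadingPair : ∀ i m →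
    ones (window x (i + i) (suc (suc m))) ≡ suc (ones (window x (suc i + suc i) m))
  ones-leadingPair i m = begin
    ones (x (i + i) ∷ x (suc (i + i)) ∷ window x (suc (suc (i + i))) m)
      ≡⟨ cong₂ (λ a b → ones (a ∷ b ∷ window x (suc (suc (i + i))) m))
               (μ∞-even z i) (μ∞-odd z i) ⟩
    ones (z i ∷ not (z i) ∷ window x (suc (suc (i + i))) m)
      ≡⟨ ones-pair (z i) _ ⟩
    suc (ones (window x (suc (suc (i + i))) m))
      ≡⟨ cong (λ q → suc (ones (window x q m))) (nextPair i) ⟩
    suc (ones (window x (suc i + suc i) m))
      ∎

  ones-oddStart : ∀ i m →
    ones (window x (suc (i + i)) (suc m)) ≡ bit (not (z i)) + ones (window x (suc i + suc i) m)
  ones-oddStart i m = begin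
    ones (x (suc (i + i)) ∷ window x (suc (suc (i + i))) m)
      ≡⟨ ones-∷ (x (suc (i + i))) _ ⟩
    bit (x (suc (i + i))) + ones (window x (suc (suc (i + i))) m)
      ≡⟨ cong₂ (λ b q → bit b + ones (window x q m)) (μ∞-odd z i) (nextPair i) ⟩
    bit (not (z i)) + ones (window x (suc i + suc i) m)
      ∎

  ones-even-even : ∀ i m → ones (window x (i + i) (m + m)) ≡ m
  ones-even-even i zero    = refl
  ones-even-even i (suc m) = begin
    ones (window x (i + i) (suc (m + suc m)))
      ≡⟨ cong (λ l → ones (window x (i + i) (suc l))) (+-suc m m) ⟩
    ones (window x (i + i) (suc (suc (m + m))))
      ≡⟨ ones-leadingPair i (m + m) ⟩
    suc (ones (window x (suc i + suc i) (m + m)))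
      ≡⟨ cong suc (ones-even-even (suc i) m) ⟩
    suc m
      ∎

  ones-even-odd : ∀ i m → ones (window x (i + i) (suc (m + m))) ≡ m + bit (z (i + m))
  ones-even-odd i zero = begin
    ones (x (i + i) ∷ [])  ≡⟨ ones-∷ (x (i + i)) [] ⟩
    bit (x (i + i)) + 0    ≡⟨ +-identityʳ _ ⟩
    bit (x (i + i))        ≡⟨ cong bit (μ∞-even z i) ⟩
    bit (z i)              ≡⟨ cong (λ j → bit (z j)) (+-identityʳ i) ⟨
    bit (z (i + 0))        ∎
  ones-even-odd i (suc m) = begin
    ones (window x (i + i) (suc (suc (m + suc m))))
      ≡⟨ cong (λ l → ones (window x (i + i) (suc (suc l)))) (+-suc m m) ⟩
    ones (window x (i + i) (suc (suc (suc (m + m)))))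
      ≡⟨ ones-leadingPair i (suc (m + m)) ⟩
    suc (ones (window x (suc i + suc i) (suc (m + m))))
      ≡⟨ cong suc (ones-even-odd (suc i) m) ⟩
    suc (m + bit (z (suc i + m)))
      ≡⟨ cong (λ j → suc (m + bit (z j))) (+-suc i m) ⟨
    suc (m + bit (z (i + suc m)))
      ∎

  ones-odd-odd : ∀ i m → ones (window x (suc (i + i)) (suc (m + m))) ≡ m + bit (not (z i))
  ones-odd-odd i m = begin
    ones (window x (suc (i + i)) (suc (m + m)))
      ≡⟨ ones-oddStart i (m + m) ⟩
    bit (not (z i)) + ones (window x (suc i + suc i) (m + m))
      ≡⟨ cong (bit (not (z i)) +_) (ones-even-even (suc i) m) ⟩
    bit (not (z i)) + m
      ≡⟨ +-comm (bit (not (z i))) m ⟩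
    m + bit (not (z i))
      ∎

  ones-odd-even : ∀ i m →
    ones (window x (suc (i + i)) (suc m + suc m)) ≡ m + (bit (not (z i)) + bit (z (suc i + m)))
  ones-odd-even i m = begin
    ones (window x (suc (i + i)) (suc (m + suc m)))
      ≡⟨ cong (λ l → ones (window x (suc (i + i)) (suc l))) (+-suc m m) ⟩
    ones (window x (suc (i + i)) (suc (suc (m + m))))
      ≡⟨ ones-oddStart i (suc (m + m)) ⟩
    bit (not (z i)) + ones (window x (suc i + suc i) (suc (m + m)))
      ≡⟨ cong (bit (not (z i)) +_) (ones-even-odd (suc i) m) ⟩
    bit (not (z i)) + (m + bit (z (suc i + m)))
      ≡⟨ x∙yz≈y∙xz (bit (not (z i))) m _ ⟩
    m + (bit (not (z i)) + bit (z (suc i + m)))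
      ∎

bit≢bit-not : ∀ b → bit b ≡ bit (not b) → ⊥
bit≢bit-not false ()
bit≢bit-not true  ()

bits-constant : ∀ a b c → bit (not a) + bit b ≡ bit (not b) + bit c → a ≡ b × b ≡ c
bits-constant false false false _ = refl , refl
bits-constant false false true  ()
bits-constant false true  false ()
bits-constant false true  true  ()
bits-constant true  false false ()
bits-constant true  false true  ()
bits-constant true  true  false ()
bits-constant true  true  true  _ = refl , refl

parity : ∀ ℓ → ∃[ j ] ℓ ≡ j + j ⊎ ∃[ j ] ℓ ≡ suc (j + j)
parity zero    = inj₁ (0 , refl)
parity (suc ℓ) with parity ℓ
... | inj₁ (j , refl) = inj₂ (j , refl)
... | inj₂ (j , refl) = inj₁ (suc j , cong suc (sym (+-suc j j)))

-- Starting positions of the blocks, written as aligned indices.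
oddPosition : ∀ n → 2 * n + 1 ≡ suc (n + n)
oddPosition = solve-∀

oddPeriod-block₂ : ∀ n j → suc (n + n) + suc (j + j) ≡ suc (n + j) + suc (n + j)
oddPeriod-block₂ = solve-∀

oddPeriod-block₃ : ∀ n j →
  suc (n + n) + suc (j + j) + suc (j + j) ≡ suc ((suc (n + j) + j) + (suc (n + j) + j))
oddPeriod-block₃ = solve-∀

evenPeriod-block₂ : ∀ n j → suc (n + n) + (suc j + suc j) ≡ suc ((n + suc j) + (n + suc j))
evenPeriod-block₂ = solve-∀

evenPeriod-lastLetter : ∀ n j → suc (n + suc j) + j ≡ n + 2 * suc j
evenPeriod-lastLetter = solve-∀

-- Odd period ℓ = 2j+1 is impossible: with k = n+2j+1 the second block has
-- j + z_k ones and the third block has j + (1 - z_k).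
oddPeriod-impossible : ∀ z n j → let ℓ = suc (j + j) in
  ones (window (μ∞ z) (suc (n + n) + ℓ) ℓ) ≡ ones (window (μ∞ z) (suc (n + n) + ℓ + ℓ) ℓ) → ⊥
oddPeriod-impossible z n j same₂₃ = bit≢bit-not (z k) (+-cancelˡ-≡ j _ _ (begin
  j + bit (z k)                                 ≡⟨ block₂ ⟨
  ones (window x (suc (n + n) + ℓ) ℓ)           ≡⟨ same₂₃ ⟩
  ones (window x (suc (n + n) + ℓ + ℓ) ℓ)       ≡⟨ block₃ ⟩
  j + bit (not (z k))                           ∎))
  where
  open WindowCounts z
  ℓ = suc (j + j)
  k = suc (n + j) + j

  block₂ : ones (window x (suc (n + n) + ℓ) ℓ) ≡ j + bit (z k)
  block₂ = trans (cong (λ q → ones (window x q ℓ)) (oddPeriod-block₂ n j))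
                 (ones-even-odd (suc (n + j)) j)

  block₃ : ones (window x (suc (n + n) + ℓ + ℓ) ℓ) ≡ j + bit (not (z k))
  block₃ = trans (cong (λ q → ones (window x q ℓ)) (oddPeriod-block₃ n j)) (ones-odd-odd k j)

-- Even period ℓ = 2k: the first two blocks have (k-1) + (1 - zₙ) + zₙ₊ₖ and
-- (k-1) + (1 - zₙ₊ₖ) + zₙ₊₂ₖ ones, so zₙ = zₙ₊ₖ = zₙ₊₂ₖ.
evenPeriod-constant : ∀ z n k →
  ones (window (μ∞ z) (suc (n + n)) (k + k)) ≡ ones (window (μ∞ z) (suc (n + n) + (k + k)) (k + k)) →
  z n ≡ z (n + k) × z (n + k) ≡ z (n + 2 * k)
evenPeriod-constant z n zero    _      = cong z (sym (+-identityʳ n)) , refl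
evenPeriod-constant z n (suc j) same₁₂ =
  bits-constant (z n) (z m) (z (n + 2 * suc j)) (+-cancelˡ-≡ j _ _ (begin
    j + (bit (not (z n)) + bit (z m))                   ≡⟨ block₁ ⟨
    ones (window x (suc (n + n)) ℓ)                     ≡⟨ same₁₂ ⟩
    ones (window x (suc (n + n) + ℓ) ℓ)                 ≡⟨ block₂ ⟩
    j + (bit (not (z m)) + bit (z (n + 2 * suc j)))     ∎))
  where
  open WindowCounts z
  ℓ = suc j + suc j
  m = n + suc j

  block₁ : ones (window x (suc (n + n)) ℓ) ≡ j + (bit (not (z n)) + bit (z m))
  block₁ = trans (ones-odd-even n j)
                 (cong (λ q → j + (bit (not (z n)) + bit (z q))) (sym (+-suc n j)))

  block₂ : ones (window x (suc (n + n) + ℓ) ℓ) ≡ j + (bit (not (z m)) + bit (z (n + 2 * suc j)))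
  block₂ = begin
    ones (window x (suc (n + n) + ℓ) ℓ)
      ≡⟨ cong (λ q → ones (window x q ℓ)) (evenPeriod-block₂ n j) ⟩
    ones (window x (suc (m + m)) ℓ)
      ≡⟨ ones-odd-even m j ⟩
    j + (bit (not (z m)) + bit (z (suc m + j)))
      ≡⟨ cong (λ q → j + (bit (not (z m)) + bit (z q))) (evenPeriod-lastLetter n j) ⟩
    j + (bit (not (z m)) + bit (z (n + 2 * suc j)))
      ∎

mainTheorem9 : (z : InfWord) (n ℓ : ℕ) →
    Abelian3Power (factor (μ∞ z) (2 * n + 1) (3 * ℓ)) ℓ →
    ∃[ k ] (ℓ ≡ 2 * k) × (z n ≡ z (n + k)) × (z (n + k) ≡ z (n + 2 * k))
mainTheorem9 z n ℓ cube
  with abelian3Power⇒equalOnes (μ∞ z) (suc (n + n)) ℓ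
         (subst (λ p → Abelian3Power (factor (μ∞ z) p (3 * ℓ)) ℓ) (oddPosition n) cube)
     | parity ℓ
... | same₁₂ , _ | inj₁ (k , refl) =
  k , cong (k +_) (sym (+-identityʳ k)) , evenPeriod-constant z n k same₁₂
... | _ , same₂₃ | inj₂ (j , refl) = ⊥-elim (oddPeriod-impossible z n j same₂₃)
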